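{- For every integer $n\ge2$, $\mathsf{AUC}_{\binom{n+1}{2}+1}\not\le^*_{\mathrm W}(\mathsf{PHP}^{n^2+1}_n)'$.
   Context: A number $N\ge1$ is identified with $\{0,\dots,N-1\}$. Problems have instances and solutions coded as elements of Baire space $\mathbb N^{\mathbb N}$. $\mathsf{P}\le^*_{\mathrm W}\mathsf{Q}$ (continuous Weihrauch reducibility) if there are continuous partial maps $\Phi,\Psi$ on $\mathbb N^{\mathbb N}$ such that for every $\mathsf{P}$-instance $p$, $\Phi(p)$ is a $\mathsf{Q}$-instance and for every $\mathsf{Q}$-solution $q$ of $\Phi(p)$, $\Psi(p,q)$ is a $\mathsf{P}$-solution of $p$. For $m>n\ge2$, $(\mathsf{PHP}^m_n)'$ has as instances all pointwise convergent sequences $(f_s:m\to n)_{s\in\mathbb N}$, with solutions all unordered pairs $\{i,j\}$, $i\ne j$, with $\lim_s f_s(i)=\lim_s f_s(j)$. For $k\ge2$, $\mathsf{AUC}_k$ has as instances those $p\in\mathbb N^{\mathbb N}$ such that either there is a unique $\ell<k$ not appearing in $p$ (then $\ell$ is the unique solution), or $p$ is the constant sequence with value $k$ (then every $j<k$ is a solution). -}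

module Defs where

open import Data.Nat using (ℕ; zero; suc; _+_; _*_; _≤_; _<_)
open import Data.Product using (Σ; ∃; ∃-syntax; _×_; _,_)
open import Data.Sum using (_⊎_)
open import Relation.Nullary using (¬_)
open import Relation.Binary.PropositionalEquality using (_≡_; _≢_)

Baire : Set
Baire = ℕ → ℕ

_≈[_]_ : Baire → ℕ → Baire → Set
p ≈[ N ] p' = ∀ k → k < N → p k ≡ p' k

record Problem : Set₁ where
  field
    Inst : Baire → Set
    Sol  : Baire → Baire → Set
open Problem public

-- Continuous Weihrauch reducibility P ≤*W Q.
-- Φ is a partial map defined (at least) on P-instances, continuous there;
-- Ψ is a partial map on pairs (p , q), defined (at least) on pairs where p is a
-- P-instance and q a Q-solution of Φ(p), jointly continuous there.
record _≤*W_ (P Q : Problem) : Set where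
  field
    Φ      : (p : Baire) → Inst P p → Baire
    Φ-cont : ∀ p h k → ∃[ N ] (∀ p' h' → p ≈[ N ] p' → Φ p' h' k ≡ Φ p h k)
    Φ-inst : ∀ p h → Inst Q (Φ p h)
    Ψ      : (p : Baire) (h : Inst P p) (q : Baire) → Sol Q (Φ p h) q → Baire
    Ψ-cont : ∀ p h q g k → ∃[ N ] (∀ p' h' q' g' → p ≈[ N ] p' → q ≈[ N ] q' →
                                      Ψ p' h' q' g' k ≡ Ψ p h q g k)
    Ψ-sol  : ∀ p h q g → Sol P p (Ψ p h q g)

-- (PHP^m_n)'
-- An instance is coded by p with f_s(i) = p (s * m + i) for i < m
-- (this is a bijection ℕ × {0..m-1} → ℕ).

seqf : (m : ℕ) → Baire → ℕ → ℕ → ℕ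
seqf m p s i = p (s * m + i)

LimIs : (m : ℕ) → Baire → ℕ → ℕ → Set
LimIs m p i v = ∃[ S ] (∀ s → S ≤ s → seqf m p s i ≡ v)

PHP′ : (m n : ℕ) → Problem
PHP′ m n = record
  { Inst = λ p → (∀ s i → i < m → seqf m p s i < n)
                 × (∀ i → i < m → ∃[ v ] LimIs m p i v)
  -- a solution codes the (unordered) pair {q 0 , q 1}; both orders are accepted
  ; Sol  = λ p q → (q 0 < m) × (q 1 < m) × (q 0 ≢ q 1)
                 × ∃[ v ] (LimIs m p (q 0) v × LimIs m p (q 1) v)
  }

UniqueMissing : ℕ → Baire → ℕ → Set
UniqueMissing k p ℓ = (ℓ < k) × (∀ s → p s ≢ ℓ)
                    × (∀ ℓ' → ℓ' < k → (∀ s → p s ≢ ℓ') → ℓ' ≡ ℓ)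

ConstK : ℕ → Baire → Set
ConstK k p = ∀ s → p s ≡ k

AUC : ℕ → Problem
AUC k = record
  { Inst = λ p → (∃[ ℓ ] UniqueMissing k p ℓ) ⊎ ConstK k p
  ; Sol  = λ p q → UniqueMissing k p (q 0) ⊎ (ConstK k p × q 0 < k)
  }

-- Feed the reduction the constant instance k^ω. Among the n² + 1 limits of Φ(k^ω) some n + 1
-- indices S share a value, so every one of the (n+1 choose 2) pairs from S is a solution, and by
-- continuity Ψ's answer to each is already determined by some finite prefix of length ≤ N.
-- Fewer than k answers arise, so some ℓ < k is none of them. The instance k^N followed by an
-- enumeration of ℕ ∖ {ℓ} agrees with k^ω up to N but has ℓ as its only solution; hence no pair
-- from S solves its Φ-image, i.e. the n + 1 limits there are pairwise distinct — impossible
-- with only n values available.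
module Submission where

open import Defs
open import Data.Nat using (ℕ; _+_; _*_; _≤_; suc)
open import Data.Nat.Combinatorics using (_C_)
open import Relation.Nullary using (¬_)

open import Data.Nat using (zero; _<_; z≤n; s≤s; z<s)
open import Data.Nat.Properties
open import Data.Nat.Combinatorics using (nC1≡n; nCk+nC[k+1]≡[n+1]C[k+1])
open import Data.Fin using (Fin; toℕ)
open import Data.Fin.Properties using (toℕ<n; toℕ-injective)
open import Data.List using (List; []; _∷_; length; map; _++_; filter; take; upTo; allFin)
open import Data.List.Properties
  using (length-map; length-removeAt′; length-++; length-upTo; length-take; length-tabulate)
open import Data.List.Membership.Propositional using (_∈_; _∉_; _─_; find)
open import Data.List.Membership.Propositional.Properties using (∈-map⁻; ∈-upTo⁺; ∈-upTo⁻)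
open import Data.List.Membership.DecPropositional _≟_ using (_∈?_)
open import Data.List.Relation.Binary.Subset.Propositional using (_⊆_)
import Data.List.Relation.Binary.Sublist.Propositional.Properties as Sublist
open import Data.List.Relation.Unary.All as All using (All; []; _∷_; all?)
open import Data.List.Relation.Unary.All.Properties as All using (all-filter; ¬All⇒Any¬)
open import Data.List.Relation.Unary.AllPairs as AllPairs using (AllPairs; []; _∷_)
import Data.List.Relation.Unary.AllPairs.Properties as AllPairs
open import Data.List.Relation.Unary.Any using (here; there; index)
open import Data.List.Relation.Unary.Unique.Propositional using (Unique)
import Data.List.Relation.Unary.Unique.Propositional.Properties as Unique
open import Data.Product using (_×_; _,_; proj₁; proj₂; ∃-syntax; ∃₂; uncurry)
open import Data.Empty using (⊥)
open import Data.Sum using (inj₁; inj₂)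
open import Function using (const; _∘_)
open import Level using (Level)
open import Relation.Nullary using (yes; no; contradiction)
open import Relation.Nullary.Decidable using (decidable-stable)
open import Relation.Unary using (Pred; Decidable)
open import Relation.Unary.Properties using (∁?)
open import Relation.Binary.PropositionalEquality

private
  variable
    a p : Level
    A : Set a

∈-─ : ∀ {x y} {ys : List A} (x∈ys : x ∈ ys) → y ∈ ys → y ≢ x → y ∈ ys ─ x∈ys
∈-─ (here refl) (here refl) y≢x = contradiction refl y≢x
∈-─ (here refl) (there y∈ys) _ = y∈ys
∈-─ (there _) (here refl) _ = here refl
∈-─ (there x∈ys) (there y∈ys) y≢x = there (∈-─ x∈ys y∈ys y≢x)

unique-⊆⇒length≤ : ∀ {xs ys : List A} → Unique xs → xs ⊆ ys → length xs ≤ length ys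
unique-⊆⇒length≤ [] _ = z≤n
unique-⊆⇒length≤ {xs = x ∷ xs} {ys} (x∉xs ∷ xs!) x∷xs⊆ys =
  subst (suc (length xs) ≤_) (sym (length-removeAt′ ys (index x∈ys)))
    (s≤s (unique-⊆⇒length≤ xs! λ y∈xs →
      ∈-─ x∈ys (x∷xs⊆ys (there y∈xs)) (≢-sym (All.lookup x∉xs y∈xs))))
  where
  x∈ys : x ∈ ys
  x∈ys = x∷xs⊆ys (here refl)

pigeonhole : ∀ (f : A → ℕ) {c} {xs : List A} →
             AllPairs (λ x y → f x ≢ f y) xs → All (λ x → f x < c) xs → length xs ≤ c
pigeonhole f {c} {xs} f-injective f<c = begin
  length xs          ≡⟨ length-map f xs ⟨
  length (map f xs)  ≤⟨ unique-⊆⇒length≤ (AllPairs.map⁺ f-injective) fxs⊆upTo ⟩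
  length (upTo c)    ≡⟨ length-upTo c ⟩
  c                  ∎
  where
  open ≤-Reasoning
  fxs⊆upTo : map f xs ⊆ upTo c
  fxs⊆upTo y∈fxs with x , x∈xs , refl ← ∈-map⁻ f y∈fxs = ∈-upTo⁺ (All.lookup f<c x∈xs)

missing-below : ∀ {k} (xs : List ℕ) → length xs < k → ∃[ ℓ ] ℓ < k × ℓ ∉ xs
missing-below {k} xs |xs|<k with all? (_∈? xs) (upTo k)
... | yes upTo⊆xs = contradiction
  (subst (_≤ length xs) (length-upTo k) (unique-⊆⇒length≤ (Unique.upTo⁺ k) (All.lookup upTo⊆xs)))
  (<⇒≱ |xs|<k)
... | no upTo⊈xs with ℓ , ℓ∈upTo , ℓ∉xs ← find (¬All⇒Any¬ (_∈? xs) (upTo k) upTo⊈xs) =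
  ℓ , ∈-upTo⁻ ℓ∈upTo , ℓ∉xs

module _ {P : Pred A p} (P? : Decidable P) where

  length-filter+length-filter-∁ : ∀ xs →
                                  length (filter P? xs) + length (filter (∁? P?) xs) ≡ length xs
  length-filter+length-filter-∁ [] = refl
  length-filter+length-filter-∁ (x ∷ xs) with P? x
  ... | yes _ = cong suc (length-filter+length-filter-∁ xs)
  ... | no _ = trans (+-suc _ _) (cong suc (length-filter+length-filter-∁ xs))

  length-filter-filter≤ : ∀ {Q : Pred A p} (Q? : Decidable Q) xs →
                          length (filter Q? (filter P? xs)) ≤ length (filter Q? xs)
  length-filter-filter≤ Q? xs =
    Sublist.length-mono-≤ (Sublist.filter⁺ Q? Q? (λ { refl q → q }) (Sublist.filter-⊆ P? xs))

large-fibre : ∀ (f : A → ℕ) c r xs → All (λ x → f x < c) xs → c * r < length xs →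
              ∃[ d ] r < length (filter (λ x → f x ≟ d) xs)
large-fibre f zero r (x ∷ xs) (() ∷ _) _
large-fibre f (suc c) r xs f<1+c r+c*r<|xs| with r <? length (filter (λ x → f x ≟ c) xs)
... | yes r<|fibre| = c , r<|fibre|
... | no r≮|fibre| =
  let d , r<|fibre′| = large-fibre f c r rest f<c c*r<|rest|
  in d , <-≤-trans r<|fibre′| (length-filter-filter≤ (∁? fibre?) (λ x → f x ≟ d) xs)
  where
  fibre? : Decidable (λ x → f x ≡ c)
  fibre? x = f x ≟ c
  rest : List _
  rest = filter (∁? fibre?) xs
  f<c : All (λ x → f x < c) rest
  f<c = All.zipWith (λ (fx<1+c , fx≢c) → ≤∧≢⇒< (≤-pred fx<1+c) fx≢c)
                    (All.filter⁺ (∁? fibre?) f<1+c , all-filter (∁? fibre?) xs)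
  c*r<|rest| : c * r < length rest
  c*r<|rest| = +-cancelˡ-< r _ _ (begin-strict
    r + c * r                                   <⟨ r+c*r<|xs| ⟩
    length xs                                   ≡⟨ length-filter+length-filter-∁ fibre? xs ⟨
    length (filter fibre? xs) + length rest     ≤⟨ +-monoˡ-≤ (length rest) (≮⇒≥ r≮|fibre|) ⟩
    r + length rest                             ∎)
    where open ≤-Reasoning

All-≡⇒AllPairs-≡ : ∀ {f : A → ℕ} {d xs} →
                   All (λ x → f x ≡ d) xs → AllPairs (λ x y → f x ≡ f y) xs
All-≡⇒AllPairs-≡ [] = []
All-≡⇒AllPairs-≡ (fx≡d ∷ fxs≡d) =
  All.map (λ fy≡d → trans fx≡d (sym fy≡d)) fxs≡d ∷ All-≡⇒AllPairs-≡ fxs≡d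

pairs : List A → List (A × A)
pairs [] = []
pairs (x ∷ xs) = map (x ,_) xs ++ pairs xs

length-pairs : ∀ (xs : List A) → length (pairs xs) ≡ length xs C 2
length-pairs [] = refl
length-pairs (x ∷ xs) = begin
  length (map (x ,_) xs ++ pairs xs)            ≡⟨ length-++ (map (x ,_) xs) ⟩
  length (map (x ,_) xs) + length (pairs xs)    ≡⟨ cong₂ _+_ (length-map (x ,_) xs) (length-pairs xs) ⟩
  length xs + length xs C 2                     ≡⟨ cong (_+ length xs C 2) (nC1≡n (length xs)) ⟨
  length xs C 1 + length xs C 2                 ≡⟨ nCk+nC[k+1]≡[n+1]C[k+1] (length xs) 1 ⟩
  suc (length xs) C 2                           ∎
  where open ≡-Reasoning

module _ {R : A → A → Set p} where

  AllPairs⇒All-pairs : ∀ {xs} → AllPairs R xs → All (uncurry R) (pairs xs)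
  AllPairs⇒All-pairs [] = []
  AllPairs⇒All-pairs (Rx ∷ Rxs) = All.++⁺ (All.map⁺ Rx) (AllPairs⇒All-pairs Rxs)

  All-pairs⇒AllPairs : ∀ xs → All (uncurry R) (pairs xs) → AllPairs R xs
  All-pairs⇒AllPairs [] _ = []
  All-pairs⇒AllPairs (x ∷ xs) Rpairs =
    let Rx , Rxs = All.++⁻ (map (x ,_) xs) Rpairs
    in All.map⁻ Rx ∷ All-pairs⇒AllPairs xs Rxs

OmitsExactly : Baire → ℕ → Set
OmitsExactly p ℓ = (∀ s → p s ≢ ℓ) × (∀ a → a ≢ ℓ → ∃[ s ] p s ≡ a)

allBut : ℕ → Baire
allBut ℓ s with s ≟ ℓ
... | yes _ = suc ℓ
... | no _ = s

allBut-omitsExactly : ∀ ℓ → OmitsExactly (allBut ℓ) ℓ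
allBut-omitsExactly ℓ = never , λ a a≢ℓ → a , attains a a≢ℓ
  where
  never : ∀ s → allBut ℓ s ≢ ℓ
  never s with s ≟ ℓ
  ... | yes _ = 1+n≢n
  ... | no s≢ℓ = s≢ℓ
  attains : ∀ a → a ≢ ℓ → allBut ℓ a ≡ a
  attains a a≢ℓ with a ≟ ℓ
  ... | yes a≡ℓ = contradiction a≡ℓ a≢ℓ
  ... | no _ = refl

prefixed : ℕ → ℕ → Baire → Baire
prefixed c zero p = p
prefixed c (suc N) p zero = c
prefixed c (suc N) p (suc s) = prefixed c N p s

const≈[]prefixed : ∀ c N p → const c ≈[ N ] prefixed c N p
const≈[]prefixed c (suc N) p zero _ = refl
const≈[]prefixed c (suc N) p (suc s) (s≤s s<N) = const≈[]prefixed c N p s s<N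

prefixed-+ : ∀ c N p s → prefixed c N p (N + s) ≡ p s
prefixed-+ c zero p s = refl
prefixed-+ c (suc N) p s = prefixed-+ c N p s

prefixed-omitsExactly : ∀ {c ℓ p} N → c ≢ ℓ → OmitsExactly p ℓ → OmitsExactly (prefixed c N p) ℓ
prefixed-omitsExactly {c} {ℓ} {p} N c≢ℓ (never , attains) = never′ N , attains′
  where
  never′ : ∀ N s → prefixed c N p s ≢ ℓ
  never′ zero s = never s
  never′ (suc N) zero = c≢ℓ
  never′ (suc N) (suc s) = never′ N s
  attains′ : ∀ a → a ≢ ℓ → ∃[ s ] prefixed c N p s ≡ a
  attains′ a a≢ℓ = let s , ps≡a = attains a a≢ℓ in N + s , trans (prefixed-+ c N p s) ps≡a

module _ {k : ℕ} where

  const-inst : Inst (AUC k) (const k)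
  const-inst = inj₂ λ _ → refl

  sol-not-attained : ∀ {p q} → Sol (AUC k) p q → ∀ s → p s ≢ q 0
  sol-not-attained (inj₁ (_ , never , _)) s = never s
  sol-not-attained (inj₂ (p≡k , q0<k)) s ps≡q0 = <⇒≢ q0<k (trans (sym ps≡q0) (p≡k s))

  omitsExactly⇒inst : ∀ {p ℓ} → ℓ < k → OmitsExactly p ℓ → Inst (AUC k) p
  omitsExactly⇒inst {ℓ = ℓ} ℓ<k (never , attains) = inj₁ (ℓ , ℓ<k , never , unique)
    where
    unique : ∀ ℓ′ → ℓ′ < k → (∀ s → _ ≢ ℓ′) → ℓ′ ≡ ℓ
    unique ℓ′ _ never′ = decidable-stable (ℓ′ ≟ ℓ) (uncurry never′ ∘ attains ℓ′)

  omitsExactly⇒sol≡ : ∀ {p ℓ q} → OmitsExactly p ℓ → Sol (AUC k) p q → q 0 ≡ ℓ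
  omitsExactly⇒sol≡ {ℓ = ℓ} {q} (_ , attains) sol =
    decidable-stable (q 0 ≟ ℓ) (uncurry (sol-not-attained {q = q} sol) ∘ attains (q 0))

pairCode : ∀ {m} → Fin m × Fin m → Baire
pairCode (i , j) zero = toℕ i
pairCode (i , j) (suc zero) = toℕ j
pairCode (i , j) (suc (suc _)) = 0

module _ {P m n} (R : P ≤*W PHP′ m n) (p : Baire) (h : Inst P p) where
  open _≤*W_ R

  limit : Fin m → ℕ
  limit i = proj₁ (proj₂ (Φ-inst p h) (toℕ i) (toℕ<n i))

  limit-isLimit : ∀ i → LimIs m (Φ p h) (toℕ i) (limit i)
  limit-isLimit i = proj₂ (proj₂ (Φ-inst p h) (toℕ i) (toℕ<n i))

  limit-< : ∀ i → limit i < n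
  limit-< i = let S , eventually = limit-isLimit i
              in subst (_< n) (eventually S ≤-refl) (proj₁ (Φ-inst p h) S (toℕ i) (toℕ<n i))

  SameLimit : Fin m → Fin m → Set
  SameLimit i j = i ≢ j × limit i ≡ limit j

  pairCode-sol : ∀ {i j} → SameLimit i j → Sol (PHP′ m n) (Φ p h) (pairCode (i , j))
  pairCode-sol {i} {j} (i≢j , limi≡limj) =
    toℕ<n i , toℕ<n j , i≢j ∘ toℕ-injective , limit i ,
    limit-isLimit i , subst (LimIs m (Φ p h) (toℕ j)) (sym limi≡limj) (limit-isLimit j)

  large-limit-class : n * n < m → ∃[ S ] length S ≡ suc n × AllPairs SameLimit S
  large-limit-class n*n<m = S , |S|≡1+n , AllPairs.zip (distinct , sameLimit)
    where
    fibre : ∃[ d ] n < length (filter (λ i → limit i ≟ d) (allFin m))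
    fibre = large-fibre limit n n (allFin m) (All.universal limit-< _)
                        (subst (n * n <_) (sym (length-tabulate _)) n*n<m)
    d : ℕ
    d = proj₁ fibre
    class : List (Fin m)
    class = filter (λ i → limit i ≟ d) (allFin m)
    S : List (Fin m)
    S = take (suc n) class
    |S|≡1+n : length S ≡ suc n
    |S|≡1+n = trans (length-take (suc n) class) (m≤n⇒m⊓n≡m (proj₂ fibre))
    distinct : Unique S
    distinct = Unique.take⁺ (suc n) (Unique.filter⁺ _ (Unique.allFin⁺ m))
    sameLimit : AllPairs (λ i j → limit i ≡ limit j) S
    sameLimit = All-≡⇒AllPairs-≡ (All.take⁺ (suc n) (all-filter _ (allFin m)))

module _ {P Q : Problem} (R : P ≤*W Q) where
  open _≤*W_ R

  StableAnswer : Baire → ℕ → Baire → ℕ → Set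
  StableAnswer p N q a = ∀ p′ h′ g′ → p ≈[ N ] p′ → Ψ p′ h′ q g′ 0 ≡ a

  StableAnswer-mono : ∀ {p N N′ q a} → N ≤ N′ → StableAnswer p N q a → StableAnswer p N′ q a
  StableAnswer-mono N≤N′ stable p′ h′ g′ p≈p′ = stable p′ h′ g′ λ s s<N → p≈p′ s (<-≤-trans s<N N≤N′)

  stable-answers : ∀ p h qs → All (Sol Q (Φ p h)) qs →
                   ∃₂ λ N as → length as ≡ length qs × All (λ q → ∃[ a ] a ∈ as × StableAnswer p N q a) qs
  stable-answers p h [] [] = 0 , [] , refl , []
  stable-answers p h (q ∷ qs) (g ∷ gs) =
    let N₁ , continuity = Ψ-cont p h q g 0
        N , as , |as|≡|qs| , stables = stable-answers p h qs gs
        stable₁ : StableAnswer p N₁ q (Ψ p h q g 0)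
        stable₁ p′ h′ g′ p≈p′ = continuity p′ h′ q g′ p≈p′ λ _ _ → refl
    in N₁ + N , Ψ p h q g 0 ∷ as , cong suc |as|≡|qs|
     , (_ , here refl , StableAnswer-mono (m≤m+n N₁ N) stable₁)
     ∷ All.map (λ (a , a∈as , stable) → a , there a∈as , StableAnswer-mono (m≤n+m N N₁) stable) stables

module _ {k Q} (R : AUC k ≤*W Q) where
  open _≤*W_ R

  stable-answer-not-sol : ∀ {p₀ N q a p ℓ} (h : Inst (AUC k) p) → StableAnswer R p₀ N q a →
                          p₀ ≈[ N ] p → OmitsExactly p ℓ → a ≢ ℓ → ¬ Sol Q (Φ p h) q
  stable-answer-not-sol {q = q} {p = p} h stable p₀≈p omits a≢ℓ g =
    a≢ℓ (trans (sym (stable p h g p₀≈p)) (omitsExactly⇒sol≡ {q = Ψ p h q g} omits (Ψ-sol p h q g)))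

AUC≰PHP′ : ∀ {k m n} → n * n < m → suc n C 2 < k → ¬ (AUC k ≤*W PHP′ m n)
AUC≰PHP′ {k} {m} {n} n*n<m 1+nC2<k R
  with S , |S|≡1+n , sameLimit₀ ← large-limit-class R (const k) const-inst n*n<m
  with N , as , |as|≡|queries| , stable ← stable-answers R (const k) const-inst (map pairCode (pairs S))
                                            (All.map⁺ (All.map (pairCode-sol R (const k) const-inst)
                                                               (AllPairs⇒All-pairs sameLimit₀)))
  = refute (missing-below as |as|<k)
  where
  |as|<k : length as < k
  |as|<k = begin-strict
    length as                         ≡⟨ |as|≡|queries| ⟩
    length (map pairCode (pairs S))   ≡⟨ length-map pairCode (pairs S) ⟩
    length (pairs S)                  ≡⟨ length-pairs S ⟩
    length S C 2                      ≡⟨ cong (_C 2) |S|≡1+n ⟩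
    suc n C 2                         <⟨ 1+nC2<k ⟩
    k                                 ∎
    where open ≤-Reasoning

  refute : ∃[ ℓ ] ℓ < k × ℓ ∉ as → ⊥
  refute (ℓ , ℓ<k , ℓ∉as) =
    1+n≰n (subst (_≤ n) |S|≡1+n (pigeonhole limit₁ separated (All.universal (limit-< R p₁ h₁) S)))
    where
    p₁ : Baire
    p₁ = prefixed k N (allBut ℓ)
    omits : OmitsExactly p₁ ℓ
    omits = prefixed-omitsExactly N (>⇒≢ ℓ<k) (allBut-omitsExactly ℓ)
    h₁ : Inst (AUC k) p₁
    h₁ = omitsExactly⇒inst ℓ<k omits
    limit₁ : Fin m → ℕ
    limit₁ = limit R p₁ h₁
    separate : ∀ {i j} → SameLimit R (const k) const-inst i j
                       × ∃[ a ] a ∈ as × StableAnswer R (const k) N (pairCode (i , j)) a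
             → limit₁ i ≢ limit₁ j
    separate {i} {j} ((i≢j , _) , a , a∈as , stable) limi≡limj =
      stable-answer-not-sol R h₁ stable (const≈[]prefixed k N (allBut ℓ)) omits
        (λ a≡ℓ → ℓ∉as (subst (_∈ as) a≡ℓ a∈as)) (pairCode-sol R p₁ h₁ (i≢j , limi≡limj))
    separated : AllPairs (λ i j → limit₁ i ≢ limit₁ j) S
    separated = All-pairs⇒AllPairs S
      (All.zipWith (λ {(i , j)} → separate) (AllPairs⇒All-pairs sameLimit₀ , All.map⁻ stable))

proposition3p7 : ∀ (n : ℕ) → 2 ≤ n → ¬ (AUC ((suc n) C 2 + 1) ≤*W PHP′ (n * n + 1) n)
proposition3p7 n _ = AUC≰PHP′ (m<m+n (n * n) z<s) (m<m+n (suc n C 2) z<s)
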